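{- Let $k,l$ be positive integers. If a matroid $M$ of positive rank is $(k,l)$-uniform, then its truncation $\tau(M)$ is $(k,l)$-uniform.
   Context: For a matroid $M$ of positive rank, the truncation $\tau(M)$ is the matroid on the same ground set whose independent sets are the independent sets of $M$ that are not bases of $M$. A matroid is $(k,l)$-uniform if it has no minor isomorphic to $U_{k,k}\oplus U_{0,l}$ ($k$ coloops and $l$ loops). -}

module Defs where

open import Data.Nat using (ℕ; _<_)
open import Data.Fin using (Fin)
open import Data.Fin.Subset using (Subset; ⁅_⁆; _∈_; _∉_; _⊆_; _∩_; _∪_; ∣_∣; ⊥; Empty; Nonempty)
open import Data.Product using (Σ; ∃; _×_)
open import Relation.Nullary using (¬_)
open import Relation.Binary.PropositionalEquality using (_≡_)
open import Level using (0ℓ; suc)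

record Matroid (n : ℕ) : Set₁ where
  field
    Indep      : Subset n → Set
    indep-∅    : Indep ⊥
    indep-⊆    : ∀ {I J} → J ⊆ I → Indep I → Indep J
    indep-aug  : ∀ {I J} → Indep I → Indep J → ∣ I ∣ < ∣ J ∣ →
                 ∃ λ x → x ∈ J × x ∉ I × Indep (I ∪ ⁅ x ⁆)

IsBasisOf : ∀ {n} → (Subset n → Set) → Subset n → Subset n → Set
IsBasisOf Ind X B = B ⊆ X × Ind B × (∀ x → x ∈ X → x ∉ B → ¬ Ind (B ∪ ⁅ x ⁆))

IsBasis : ∀ {n} → (Subset n → Set) → Subset n → Set
IsBasis Ind B = Ind B × (∀ x → x ∉ B → ¬ Ind (B ∪ ⁅ x ⁆))

PositiveRank : ∀ {n} → Matroid n → Set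
PositiveRank M = ∃ λ I → Matroid.Indep M I × Nonempty I

TruncIndep : ∀ {n} → Matroid n → Subset n → Set
TruncIndep M I = Matroid.Indep M I × ¬ IsBasis (Matroid.Indep M) I

ContractIndep : ∀ {n} → (Subset n → Set) → Subset n → Subset n → Set
ContractIndep Ind C X = Empty (X ∩ C) × ∃ λ B → IsBasisOf Ind C B × Ind (X ∪ B)

Disj : ∀ {n} → Subset n → Subset n → Set
Disj A B = Empty (A ∩ B)

-- M has a minor M/C\D isomorphic to U_{k,k} ⊕ U_{0,l}: the ground set splits
-- into disjoint C (contracted), D (deleted), K and L with |K| = k, |L| = l,
-- and the independent sets of M/C\D (on ground set K ∪ L) are exactly the
-- subsets of K (K = the k coloops, L = the l loops).
HasUkkUl0Minor : ∀ {n} → ℕ → ℕ → (Subset n → Set) → Set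
HasUkkUl0Minor {n} k l Ind =
  Σ (Subset n) λ C → Σ (Subset n) λ D → Σ (Subset n) λ K → Σ (Subset n) λ L →
    Disj C D × Disj C K × Disj C L × Disj D K × Disj D L × Disj K L ×
    (∀ (x : Fin n) → x ∈ C ∪ D ∪ K ∪ L) ×
    ∣ K ∣ ≡ k × ∣ L ∣ ≡ l ×
    (∀ X → X ⊆ K ∪ L → (ContractIndep Ind C X → X ⊆ K) × (X ⊆ K → ContractIndep Ind C X))

KLUniform : ∀ {n} → ℕ → ℕ → (Subset n → Set) → Set
KLUniform k l Ind = ¬ HasUkkUl0Minor k l Ind

{-# OPTIONS --safe #-}
module Submission where

-- Let τ(M)/C\D be the minor, with coloops K ≠ ∅, and B a basis of C in τ(M).
-- Then K ∪ B is M-independent but not an M-basis, so no M-independent set of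
-- size at most |K ∪ B| is an M-basis: all such sets are τ(M)-independent.
-- As |B| < |K ∪ B|, B is a basis of C in M, all bases of C in M have size at
-- most |B|, and a set of size at most |B| + 1 is independent in M iff it is in
-- τ(M). This suffices to compare M/C\D with τ(M)/C\D on subsets of K and on
-- singletons, so the same minor U_{k,k} ⊕ U_{0,l} occurs in M.

open import Defs
open import Data.Nat using (ℕ; NonZero; suc; _+_; _≤_; _<_; z≤n; s≤s)
open import Data.Nat.Properties
  using (≤-trans; ≤-<-trans; <⇒≤; <⇒≱; ≮⇒≥; _<?_; +-comm; +-suc; +-monoʳ-≤; 0≢1+n; module ≤-Reasoning)
open import Data.Bool using (true; false)
open import Data.Vec using ([]; _∷_)
open import Data.Fin using (Fin)
open import Data.Fin.Subset using (Subset; ⁅_⁆; _∈_; _∉_; _⊆_; _∪_; ∣_∣; Nonempty)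
open import Data.Fin.Subset.Properties
open import Data.Product using (_×_; _,_; proj₁; proj₂)
open import Data.Sum using (inj₁; inj₂)
open import Function using (id)
open import Relation.Nullary using (¬_; yes; no; contradiction)
open import Relation.Binary.PropositionalEquality using (_≡_; sym; trans; cong; subst)

∣p∪q∣≤∣p∣+∣q∣ : ∀ {n} (p q : Subset n) → ∣ p ∪ q ∣ ≤ ∣ p ∣ + ∣ q ∣
∣p∪q∣≤∣p∣+∣q∣ []          []          = z≤n
∣p∪q∣≤∣p∣+∣q∣ (true ∷ p)  (t ∷ q)     =
  s≤s (≤-trans (∣p∪q∣≤∣p∣+∣q∣ p q) (+-monoʳ-≤ ∣ p ∣ (∣p∣≤∣x∷p∣ t q)))
∣p∪q∣≤∣p∣+∣q∣ (false ∷ p) (true ∷ q)  =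
  subst (suc ∣ p ∪ q ∣ ≤_) (sym (+-suc ∣ p ∣ ∣ q ∣)) (s≤s (∣p∪q∣≤∣p∣+∣q∣ p q))
∣p∪q∣≤∣p∣+∣q∣ (false ∷ p) (false ∷ q) = ∣p∪q∣≤∣p∣+∣q∣ p q

∣p∪⁅x⁆∣≤1+∣p∣ : ∀ {n} (p : Subset n) (x : Fin n) → ∣ p ∪ ⁅ x ⁆ ∣ ≤ suc ∣ p ∣
∣p∪⁅x⁆∣≤1+∣p∣ p x = begin
  ∣ p ∪ ⁅ x ⁆ ∣      ≤⟨ ∣p∪q∣≤∣p∣+∣q∣ p ⁅ x ⁆ ⟩
  ∣ p ∣ + ∣ ⁅ x ⁆ ∣  ≡⟨ cong (∣ p ∣ +_) (∣⁅x⁆∣≡1 x) ⟩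
  ∣ p ∣ + 1          ≡⟨ +-comm ∣ p ∣ 1 ⟩
  suc ∣ p ∣          ∎
  where open ≤-Reasoning

∣⁅x⁆∪p∣≤1+∣p∣ : ∀ {n} (p : Subset n) (x : Fin n) → ∣ ⁅ x ⁆ ∪ p ∣ ≤ suc ∣ p ∣
∣⁅x⁆∪p∣≤1+∣p∣ p x = subst (_≤ suc ∣ p ∣) (cong ∣_∣ (∪-comm p ⁅ x ⁆)) (∣p∪⁅x⁆∣≤1+∣p∣ p x)

∣q∣<∣p∪q∣ : ∀ {n} {p q : Subset n} {x : Fin n} → x ∈ p → x ∉ q → ∣ q ∣ < ∣ p ∪ q ∣
∣q∣<∣p∪q∣ {p = p} {q} x∈p x∉q = p⊂q⇒∣p∣<∣q∣ (q⊆p∪q p q , _ , x∈p∪q⁺ (inj₁ x∈p) , x∉q)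

∣p∣<∣p∪⁅x⁆∣ : ∀ {n} {p : Subset n} {x : Fin n} → x ∉ p → ∣ p ∣ < ∣ p ∪ ⁅ x ⁆ ∣
∣p∣<∣p∪⁅x⁆∣ {p = p} {x} x∉p = p⊂q⇒∣p∣<∣q∣ (p⊆p∪q ⁅ x ⁆ , x , x∈p∪q⁺ (inj₂ (x∈⁅x⁆ x)) , x∉p)

∪-monoˡ-⊆ : ∀ {n} {p q r : Subset n} → p ⊆ q → p ∪ r ⊆ q ∪ r
∪-monoˡ-⊆ {p = p} {r = r} p⊆q x∈p∪r with x∈p∪q⁻ p r x∈p∪r
... | inj₁ x∈p = x∈p∪q⁺ (inj₁ (p⊆q x∈p))
... | inj₂ x∈r = x∈p∪q⁺ (inj₂ x∈r)

⁅x⁆⊆p : ∀ {n} {p : Subset n} {x : Fin n} → x ∈ p → ⁅ x ⁆ ⊆ p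
⁅x⁆⊆p {x = x} x∈p y∈⁅x⁆ = subst (_∈ _) (sym (x∈⁅y⁆⇒x≡y x y∈⁅x⁆)) x∈p

Disj-⊆ˡ : ∀ {n} {p q r : Subset n} → p ⊆ q → Disj q r → Disj p r
Disj-⊆ˡ {p = p} {r = r} p⊆q q∩r≡∅ (x , x∈p∩r) =
  q∩r≡∅ (x , x∈p∩q⁺ (p⊆q (p∩q⊆p p r x∈p∩r) , p∩q⊆q p r x∈p∩r))

∣p∣≡1+k⇒Nonempty : ∀ {n k} {p : Subset n} → ∣ p ∣ ≡ suc k → Nonempty p
∣p∣≡1+k⇒Nonempty {n} {p = p} ∣p∣≡1+k with nonempty? p
... | yes p≢∅ = p≢∅
... | no  p≡∅ = contradiction
  (trans (sym (∣⊥∣≡0 n)) (trans (cong ∣_∣ (sym (Empty-unique p≡∅))) ∣p∣≡1+k)) 0≢1+n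

module _ {n : ℕ} (M : Matroid n) where
  open Matroid M

  basis-largest : ∀ {B I} → IsBasis Indep B → Indep I → ∣ I ∣ ≤ ∣ B ∣
  basis-largest {B} {I} (indB , maxB) indI with ∣ B ∣ <? ∣ I ∣
  ... | no  B≮I = ≮⇒≥ B≮I
  ... | yes B<I with indep-aug indB indI B<I
  ...   | x , _ , x∉B , indBx = contradiction indBx (maxB x x∉B)

  basisOf-largest : ∀ {C B I} → IsBasisOf Indep C B → I ⊆ C → Indep I → ∣ I ∣ ≤ ∣ B ∣
  basisOf-largest {C} {B} {I} (_ , indB , maxB) I⊆C indI with ∣ B ∣ <? ∣ I ∣
  ... | no  B≮I = ≮⇒≥ B≮I
  ... | yes B<I with indep-aug indB indI B<I
  ...   | x , x∈I , x∉B , indBx = contradiction indBx (maxB x (I⊆C x∈I) x∉B)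

  ¬IsBasis-≤ : ∀ {I J} → Indep J → ¬ IsBasis Indep J → Indep I → ∣ I ∣ ≤ ∣ J ∣ →
               ¬ IsBasis Indep I
  ¬IsBasis-≤ {J = J} indJ ¬basisJ indI I≤J basisI = ¬basisJ (indJ , maxJ)
    where
    maxJ : ∀ x → x ∉ J → ¬ Indep (J ∪ ⁅ x ⁆)
    maxJ x x∉J indJx =
      contradiction (basis-largest basisI indJx) (<⇒≱ (≤-<-trans I≤J (∣p∣<∣p∪⁅x⁆∣ x∉J)))

  contractIndep-⊆ : ∀ {C X Y} → Y ⊆ X → ContractIndep Indep C X → ContractIndep Indep C Y
  contractIndep-⊆ Y⊆X (X∩C≡∅ , B , basisB , indX∪B) =
    Disj-⊆ˡ Y⊆X X∩C≡∅ , B , basisB , indep-⊆ (∪-monoˡ-⊆ Y⊆X) indX∪B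

  module _ {J : Subset n} (τJ : TruncIndep M J) where

    truncIndep-≤ : ∀ {I} → Indep I → ∣ I ∣ ≤ ∣ J ∣ → TruncIndep M I
    truncIndep-≤ indI I≤J = indI , ¬IsBasis-≤ (proj₁ τJ) (proj₂ τJ) indI I≤J

    trunc-basisOf⁺ : ∀ {C B} → IsBasisOf Indep C B → ∣ B ∣ < ∣ J ∣ →
                     IsBasisOf (TruncIndep M) C B
    trunc-basisOf⁺ (B⊆C , indB , maxB) B<J =
      B⊆C , truncIndep-≤ indB (<⇒≤ B<J) , λ x x∈C x∉B τB∪x → maxB x x∈C x∉B (proj₁ τB∪x)

    trunc-basisOf⁻ : ∀ {C B} → IsBasisOf (TruncIndep M) C B → ∣ B ∣ < ∣ J ∣ →
                     IsBasisOf Indep C B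
    trunc-basisOf⁻ {B = B} (B⊆C , τB , maxB) B<J =
      B⊆C , proj₁ τB , λ x x∈C x∉B indB∪x →
        maxB x x∈C x∉B (truncIndep-≤ indB∪x (≤-trans (∣p∪⁅x⁆∣≤1+∣p∣ B x) B<J))

  module TruncatedColoops {C K B : Subset n} (K≢∅ : Nonempty K) (K∩C≡∅ : Disj K C)
           (τB : IsBasisOf (TruncIndep M) C B) (τK∪B : TruncIndep M (K ∪ B)) where

    B<K∪B : ∣ B ∣ < ∣ K ∪ B ∣
    B<K∪B = ∣q∣<∣p∪q∣ (proj₂ K≢∅) λ y∈B →
      K∩C≡∅ (_ , x∈p∩q⁺ (proj₂ K≢∅ , proj₁ τB y∈B))

    basisB : IsBasisOf Indep C B
    basisB = trunc-basisOf⁻ τK∪B τB B<K∪B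

    contractIndep-⊆K : ∀ {X} → X ⊆ K → ContractIndep Indep C X
    contractIndep-⊆K X⊆K = contractIndep-⊆ X⊆K (K∩C≡∅ , B , basisB , proj₁ τK∪B)

    truncContractIndep-⁅⁆ : ∀ {x} → ContractIndep Indep C ⁅ x ⁆ →
                            ContractIndep (TruncIndep M) C ⁅ x ⁆
    truncContractIndep-⁅⁆ {x} (x∩C≡∅ , B′ , basisB′@(B′⊆C , indB′ , _) , indx∪B′) =
      x∩C≡∅ , B′ , trunc-basisOf⁺ τK∪B basisB′ B′<K∪B ,
      truncIndep-≤ τK∪B indx∪B′ (≤-trans (∣⁅x⁆∪p∣≤1+∣p∣ B′ x) B′<K∪B)
      where
      B′<K∪B : ∣ B′ ∣ < ∣ K ∪ B ∣
      B′<K∪B = ≤-<-trans (basisOf-largest basisB B′⊆C indB′) B<K∪B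

lemma4p1 : (k l : ℕ) → NonZero k → NonZero l → (n : ℕ) (M : Matroid n) →
    PositiveRank M → KLUniform k l (Matroid.Indep M) → KLUniform k l (TruncIndep M)
lemma4p1 (suc k) l _ _ n M _ uniformM
  (C , D , K , L , dCD , dCK , dCL , dDK , dDL , dKL , cover , ∣K∣≡k , ∣L∣≡l , τminor)
  with proj₂ (τminor K (p⊆p∪q L)) id
... | K∩C≡∅ , B , τB , τK∪B =
  uniformM (C , D , K , L , dCD , dCK , dCL , dDK , dDL , dKL , cover , ∣K∣≡k , ∣L∣≡l , minor)
  where
  open Matroid M using (Indep)
  open TruncatedColoops M (∣p∣≡1+k⇒Nonempty ∣K∣≡k) K∩C≡∅ τB τK∪B

  minor : ∀ X → X ⊆ K ∪ L →
          (ContractIndep Indep C X → X ⊆ K) × (X ⊆ K → ContractIndep Indep C X)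
  minor X X⊆K∪L = coloops , contractIndep-⊆K
    where
    coloops : ContractIndep Indep C X → X ⊆ K
    coloops X/C {x} x∈X =
      proj₁ (τminor ⁅ x ⁆ (⊆-trans (⁅x⁆⊆p x∈X) X⊆K∪L))
        (truncContractIndep-⁅⁆ (contractIndep-⊆ M (⁅x⁆⊆p x∈X) X/C)) (x∈⁅x⁆ x)
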